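{- For $n\ge 1$, \[N_{n+1}(q)=\sum_{k=0}^{n}q^{\binom{k+1}{2}}\sum_{\pi\in S_n}q^{a_k(\pi)}q^{\operatorname{ninvsum}(\pi)} =N_n(q)+\sum_{k=1}^{n-1}q^{\binom{k+1}{2}}\sum_{\pi\in S_n}q^{z_k(\pi)}q^{\operatorname{ninvsum}(\pi)}+q^{\binom{n+1}{2}}N_n(q),\] where $\binom{1}{2}=0$.
   Context: $S_n$ is the set of permutations of $\{1,\dots,n\}$. A non-inversion of $\pi$ is a pair $(a,b)$ with $1\le a<b\le n$ and $\pi(a)<\pi(b)$; $\operatorname{ninvsum}(\pi)$ is the sum of $b-a$ over all non-inversions. $N_n(q)=\sum_{\pi\in S_n}q^{\operatorname{ninvsum}(\pi)}$. For $1\le k\le n-1$, $z_k(\pi)$ is the number of non-inversions $(a,b)$ of $\pi$ with $a\le k<b$; the augmented non-inversion zone-crossing vector is $(a_0(\pi),\dots,a_n(\pi))=(0,z_1(\pi),\dots,z_{n-1}(\pi),0)$. -}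

module Defs where

open import Level using (Level)
import Data.Nat as ℕ
open import Data.Nat using (ℕ; zero; suc; _∸_; _<_; _≤_; _<?_; _≤?_; _≟_)
open import Data.Fin as F using (Fin; toℕ)
open import Data.Vec using (Vec; []; _∷_; lookup; toList)
open import Data.List as L using (List; []; _∷_; map; concatMap; filter; allFin; upTo)
open import Data.Product using (_×_; _,_)
open import Relation.Nullary using (yes; no)
open import Relation.Nullary.Decidable using (_×-dec_)
open import Algebra.Bundles using (CommutativeSemiring)
import Data.List.Relation.Unary.Unique.DecPropositional as UniqueDec
open import Data.Nat.Combinatorics using (_C_)

allVecs : (m n : ℕ) → List (Vec (Fin n) m)
allVecs zero    n = [] ∷ []
allVecs (suc m) n = concatMap (λ x → map (x ∷_) (allVecs m n)) (allFin n)

-- A permutation of {1..n} is represented by its one-line notation: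
-- position i ↦ lookup π i, 0-based (Fin n); injective (hence bijective).
S : (n : ℕ) → List (Vec (Fin n) n)
S n = filter (λ v → UniqueDec.unique? F._≟_ (toList v)) (allVecs n n)

pairs : (n : ℕ) → List (Fin n × Fin n)
pairs n = concatMap (λ a → map (a ,_) (allFin n)) (allFin n)

nonInversions : {n : ℕ} → Vec (Fin n) n → List (Fin n × Fin n)
nonInversions {n} π =
  filter (λ { (a , b) → (toℕ a <? toℕ b) ×-dec (toℕ (lookup π a) <? toℕ (lookup π b)) }) (pairs n)

sumℕ : List ℕ → ℕ
sumℕ = L.foldr ℕ._+_ 0

ninvsum : {n : ℕ} → Vec (Fin n) n → ℕ
ninvsum π = sumℕ (map (λ { (a , b) → toℕ b ∸ toℕ a }) (nonInversions π))

-- z k π = #{ non-inversions (a , b) with a ≤ k < b } in 1-based positions.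
-- With 0-based positions a' = a - 1, b' = b - 1 this reads a' < k ≤ b'.
z : {n : ℕ} → ℕ → Vec (Fin n) n → ℕ
z k π = L.length (filter (λ { (a , b) → (toℕ a <? k) ×-dec (k ≤? toℕ b) }) (nonInversions π))

-- augmented vector (a_0 , … , a_n) = (0 , z_1 , … , z_{n-1} , 0)
aug : {n : ℕ} → ℕ → Vec (Fin n) n → ℕ
aug {n} zero π = 0
aug {n} (suc k) π with suc k ≟ n
... | yes _ = 0
... | no  _ = z (suc k) π

-- Polynomial expressions evaluated at an arbitrary element q of an arbitrary
-- commutative semiring (equality for all such is equality in ℕ[q]).
module Poly {c ℓ : Level} (R : CommutativeSemiring c ℓ) where
  open CommutativeSemiring R
  open import Algebra.Definitions.RawSemiring rawSemiring using (_^_)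

  sumR : List Carrier → Carrier
  sumR = L.foldr _+_ 0#

  N : ℕ → Carrier → Carrier
  N n q = sumR (map (λ π → q ^ ninvsum π) (S n))

  Aterm : ℕ → ℕ → Carrier → Carrier
  Aterm n k q = sumR (map (λ π → (q ^ aug k π) * (q ^ ninvsum π)) (S n))

  Zterm : ℕ → ℕ → Carrier → Carrier
  Zterm n k q = sumR (map (λ π → (q ^ z k π) * (q ^ ninvsum π)) (S n))

  middle : ℕ → Carrier → Carrier
  middle n q = sumR (map (λ k → (q ^ (suc k C 2)) * Aterm n k q) (upTo (suc n)))

  right : ℕ → Carrier → Carrier
  right n q = (N n q + sumR (map (λ k → (q ^ (suc (suc k) C 2)) * Zterm n (suc k) q) (upTo (n ∸ 1))))
              + (q ^ (suc n C 2)) * N n q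

module Submission where

-- Every permutation of {1,…,n+1} arises exactly once by inserting the new maximum n+1 into a
-- permutation π of {1,…,n} at some slot k ∈ {0,…,n} (k entries to its left).  The maximum forms a
-- non-inversion with each of those k entries, adding 1 + 2 + ⋯ + k = C(k+1,2) to ninvsum, and an
-- old non-inversion (a,b) grows by one exactly when it straddles the slot, i.e. a ≤ k < b; there are
-- z_k(π) of these, and none when k = 0 or k = n, which is why the augmented vector a_k appears.  So
-- ninvsum(ins_k π) = C(k+1,2) + a_k(π) + ninvsum(π), and summing q^ninvsum over all (k,π) gives the
-- first equality; the second splits off the terms k = 0 and k = n.

open import Defs
open import Level using (Level)
open import Function using (_∘_; id; mk⇔; Equivalence)
open import Data.Bool using (Bool; true; false; if_then_else_; _∧_)
open import Data.Bool.Properties using (T-≡; if-eta; ∧-zeroʳ)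
open import Data.Empty using (⊥-elim)
open import Data.Nat as ℕ using (ℕ; zero; suc; _∸_; _≤_; _<_; _≥_; _<ᵇ_; _≤ᵇ_; _≟_; z≤n; s≤s; z<s; s<s)
import Data.Nat.Properties as ℕₚ
open import Data.Nat.Combinatorics using (_C_; nC1≡n; nCk+nC[k+1]≡[n+1]C[k+1])
open import Data.Fin as Fin using (Fin; toℕ; fromℕ; inject₁; lower₁)
open import Data.Fin.Properties
  using (toℕ-fromℕ; toℕ-inject₁; toℕ<n; toℕ≤pred[n]; toℕ-injective; inject₁-injective; inject₁-lower₁;
         fromℕ≢inject₁; pigeonhole; <⇒≢)
open import Data.Vec as Vec using (Vec; []; _∷_; lookup; toList; insertAt; removeAt)
open import Data.Vec.Properties using (∷-injective; toList-map; insertAt-removeAt)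
open import Data.Vec.Membership.Propositional.Properties using (∈-lookup; ∈-toList⁺; ∈-toList⁻)
open import Data.Vec.Relation.Unary.Any using (index)
open import Data.Vec.Relation.Unary.Any.Properties using (lookup-index)
open import Data.List as List
  using (List; []; _∷_; _++_; map; filter; concatMap; allFin; applyUpTo; upTo; tabulate; cartesianProductWith)
open import Data.List.Properties using (map-++; map-∘; map-cong; map-tabulate; map-applyUpTo; applyUpTo-∷ʳ)
open import Data.List.Relation.Unary.All as All using (All; []; _∷_)
import Data.List.Relation.Unary.All.Properties as Allₚ
open import Data.List.Relation.Unary.AllPairs as AllPairs using ([]; _∷_)
open import Data.List.Relation.Unary.Any using (here; there)
open import Data.List.Relation.Unary.Unique.Propositional using (Unique)
import Data.List.Relation.Unary.Unique.Propositional.Properties as Unique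
import Data.List.Relation.Unary.Unique.DecPropositional as UniqueDec
open import Data.List.Membership.Propositional using (_∈_)
open import Data.List.Membership.Propositional.Properties
  using (∈-cartesianProductWith⁺; ∈-cartesianProductWith⁻; ∈-allFin; ∈-filter⁺; ∈-filter⁻)
import Data.List.Membership.DecPropositional as ∈Dec
open import Data.List.Membership.Propositional.Properties.WithK using (unique∧set⇒bag)
open import Data.List.Relation.Binary.BagAndSetEquality using (∼bag⇒↭)
open import Data.List.Relation.Binary.Permutation.Propositional
  using (_↭_; ↭-refl; ↭-prep; ↭-swap; ↭-trans; ↭-sym; ↭⇒↭ₛ; ↭⇒↭ₛ′)
import Data.List.Relation.Binary.Permutation.Propositional.Properties as ↭
import Data.List.Relation.Binary.Permutation.Setoid.Properties as ↭ₛ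
open import Data.Product using (_×_; _,_; ∃; proj₁; proj₂)
open import Relation.Nullary using (does; yes; no)
open import Relation.Unary using (Pred; Decidable)
open import Relation.Binary.PropositionalEquality as ≡
  using (_≡_; _≢_; refl; sym; trans; cong; cong₂; subst; module ≡-Reasoning)
open import Algebra.Bundles using (CommutativeMonoid; CommutativeSemiring)

concatMap-map≡cartesianProductWith : ∀ {a b c} {A : Set a} {B : Set b} {C : Set c} (f : A → B → C) xs ys →
  concatMap (λ x → map (f x) ys) xs ≡ cartesianProductWith f xs ys
concatMap-map≡cartesianProductWith f []       ys = refl
concatMap-map≡cartesianProductWith f (x ∷ xs) ys = cong (map (f x) ys ++_) (concatMap-map≡cartesianProductWith f xs ys)

module ListSum {c ℓ} (M : CommutativeMonoid c ℓ) where
  open CommutativeMonoid M renaming (refl to ≈-refl; sym to ≈-sym; trans to ≈-trans)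
  open import Algebra.Properties.CommutativeSemigroup commutativeSemigroup using (interchange)
  open import Relation.Binary.Reasoning.Setoid setoid

  sum : List Carrier → Carrier
  sum = List.foldr _∙_ ε

  sumUpTo : ℕ → (ℕ → Carrier) → Carrier
  sumUpTo l h = sum (applyUpTo h l)

  sum-map-cong : ∀ {a} {A : Set a} {f g : A → Carrier} xs → (∀ x → f x ≈ g x) → sum (map f xs) ≈ sum (map g xs)
  sum-map-cong []       f≈g = ≈-refl
  sum-map-cong (x ∷ xs) f≈g = ∙-cong (f≈g x) (sum-map-cong xs f≈g)

  sum-++ : ∀ xs ys → sum (xs ++ ys) ≈ sum xs ∙ sum ys
  sum-++ []       ys = ≈-sym (identityˡ _)
  sum-++ (x ∷ xs) ys = ≈-trans (∙-congˡ (sum-++ xs ys)) (≈-sym (assoc _ _ _))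

  sum-concatMap : ∀ {a b} {A : Set a} {B : Set b} (f : B → Carrier) (g : A → List B) xs →
    sum (map f (concatMap g xs)) ≈ sum (map (λ x → sum (map f (g x))) xs)
  sum-concatMap f g []       = ≈-refl
  sum-concatMap f g (x ∷ xs) = begin
    sum (map f (g x ++ concatMap g xs))              ≡⟨ cong sum (map-++ f (g x) _) ⟩
    sum (map f (g x) ++ map f (concatMap g xs))      ≈⟨ sum-++ (map f (g x)) _ ⟩
    sum (map f (g x)) ∙ sum (map f (concatMap g xs)) ≈⟨ ∙-congˡ (sum-concatMap f g xs) ⟩
    sum (map f (g x)) ∙ sum (map (λ x → sum (map f (g x))) xs) ∎

  sum-cartesianProductWith : ∀ {a b c} {A : Set a} {B : Set b} {C : Set c} (f : C → Carrier) (g : A → B → C) xs ys →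
    sum (map f (cartesianProductWith g xs ys)) ≈ sum (map (λ x → sum (map (f ∘ g x) ys)) xs)
  sum-cartesianProductWith f g xs ys = begin
    sum (map f (cartesianProductWith g xs ys))
      ≡⟨ cong (sum ∘ map f) (sym (concatMap-map≡cartesianProductWith g xs ys)) ⟩
    sum (map f (concatMap (λ x → map (g x) ys) xs))
      ≈⟨ sum-concatMap f _ xs ⟩
    sum (map (λ x → sum (map f (map (g x) ys))) xs)
      ≡⟨ cong sum (map-cong (λ x → cong sum (sym (map-∘ ys))) xs) ⟩
    sum (map (λ x → sum (map (f ∘ g x) ys)) xs) ∎

  sum-filter : ∀ {a p} {A : Set a} {P : Pred A p} (P? : Decidable P) (f : A → Carrier) xs →
    sum (map f (filter P? xs)) ≈ sum (map (λ x → if does (P? x) then f x else ε) xs)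
  sum-filter P? f []       = ≈-refl
  sum-filter P? f (x ∷ xs) with does (P? x)
  ... | true  = ∙-congˡ (sum-filter P? f xs)
  ... | false = ≈-trans (sum-filter P? f xs) (≈-sym (identityˡ _))

  sum-map-↭ : ∀ {a} {A : Set a} (f : A → Carrier) {xs ys} → xs ↭ ys → sum (map f xs) ≈ sum (map f ys)
  sum-map-↭ f xs↭ys = ↭ₛ.foldr-commMonoid setoid isCommutativeMonoid (↭⇒↭ₛ′ isEquivalence (↭.map⁺ f xs↭ys))

  sum-tabulate : ∀ n (f : Fin n → Carrier) (h : ℕ → Carrier) → (∀ i → f i ≈ h (toℕ i)) →
    sum (tabulate f) ≈ sumUpTo n h
  sum-tabulate zero    f h f≈h = ≈-refl
  sum-tabulate (suc n) f h f≈h = ∙-cong (f≈h Fin.zero) (sum-tabulate n (f ∘ Fin.suc) (h ∘ suc) (f≈h ∘ Fin.suc))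

  sum-map-allFin : ∀ n (f : Fin n → Carrier) (h : ℕ → Carrier) → (∀ i → f i ≈ h (toℕ i)) →
    sum (map f (allFin n)) ≈ sumUpTo n h
  sum-map-allFin n f h f≈h = ≈-trans (reflexive (cong sum (map-tabulate id f))) (sum-tabulate n f h f≈h)

  sum-map-upTo : ∀ n (f : ℕ → Carrier) → sum (map f (upTo n)) ≡ sumUpTo n f
  sum-map-upTo n f = cong sum (map-applyUpTo id f n)

  sumUpTo-cong : ∀ l {f g : ℕ → Carrier} → (∀ i → i < l → f i ≈ g i) → sumUpTo l f ≈ sumUpTo l g
  sumUpTo-cong zero    f≈g = ≈-refl
  sumUpTo-cong (suc l) f≈g = ∙-cong (f≈g 0 z<s) (sumUpTo-cong l (λ i i<l → f≈g (suc i) (s<s i<l)))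

  sumUpTo-ε : ∀ l {f : ℕ → Carrier} → (∀ i → i < l → f i ≈ ε) → sumUpTo l f ≈ ε
  sumUpTo-ε zero    f≈ε = ≈-refl
  sumUpTo-ε (suc l) f≈ε = ≈-trans (∙-cong (f≈ε 0 z<s) (sumUpTo-ε l (λ i i<l → f≈ε (suc i) (s<s i<l)))) (identityˡ ε)

  sumUpTo-distrib : ∀ l (f g : ℕ → Carrier) → sumUpTo l (λ i → f i ∙ g i) ≈ sumUpTo l f ∙ sumUpTo l g
  sumUpTo-distrib zero    f g = ≈-sym (identityˡ ε)
  sumUpTo-distrib (suc l) f g = ≈-trans (∙-congˡ (sumUpTo-distrib l (f ∘ suc) (g ∘ suc))) (interchange _ _ _ _)

  sumUpTo-suc : ∀ l (h : ℕ → Carrier) → sumUpTo (suc l) h ≈ sumUpTo l h ∙ h l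
  sumUpTo-suc l h = begin
    sum (applyUpTo h (suc l))            ≡⟨ cong sum (sym (applyUpTo-∷ʳ h l)) ⟩
    sum (applyUpTo h l ++ h l ∷ [])      ≈⟨ sum-++ (applyUpTo h l) _ ⟩
    sumUpTo l h ∙ (h l ∙ ε)              ≈⟨ ∙-congˡ (identityʳ _) ⟩
    sumUpTo l h ∙ h l                    ∎

allVecs≡cartesianProductWith : ∀ l m → allVecs (suc l) m ≡ cartesianProductWith _∷_ (allFin m) (allVecs l m)
allVecs≡cartesianProductWith l m = concatMap-map≡cartesianProductWith _∷_ (allFin m) (allVecs l m)

allVecs-unique : ∀ l m → Unique (allVecs l m)
allVecs-unique zero    m = [] ∷ []
allVecs-unique (suc l) m rewrite allVecs≡cartesianProductWith l m =
  Unique.cartesianProductWith⁺ _∷_ ∷-injective (Unique.allFin⁺ m) (allVecs-unique l m)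

∈-allVecs : ∀ {l m} (v : Vec (Fin m) l) → v ∈ allVecs l m
∈-allVecs []                = here refl
∈-allVecs {suc l} {m} (x ∷ v) rewrite allVecs≡cartesianProductWith l m =
  ∈-cartesianProductWith⁺ _∷_ (∈-allFin x) (∈-allVecs v)

S-unique : ∀ m → Unique (S m)
S-unique m = Unique.filter⁺ _ (allVecs-unique m m)

∈-S⁺ : ∀ {m} {v : Vec (Fin m) m} → Unique (toList v) → v ∈ S m
∈-S⁺ {m} {v} = ∈-filter⁺ (λ v → UniqueDec.unique? Fin._≟_ (toList v)) (∈-allVecs v)

∈-S⁻ : ∀ {m} {v : Vec (Fin m) m} → v ∈ S m → Unique (toList v)
∈-S⁻ {m} v∈S = proj₂ (∈-filter⁻ (λ v → UniqueDec.unique? Fin._≟_ (toList v)) {xs = allVecs m m} v∈S)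

unique-resp-↭ : ∀ {a} {A : Set a} {xs ys : List A} → xs ↭ ys → Unique xs → Unique ys
unique-resp-↭ {A = A} xs↭ys = ↭ₛ.Unique-resp-↭ (≡.setoid A) (↭⇒↭ₛ xs↭ys)

insertMax : ∀ {m l} → Fin (suc l) → Vec (Fin m) l → Vec (Fin (suc m)) (suc l)
insertMax {m} k π = insertAt (Vec.map inject₁ π) k (fromℕ m)

toList-insertAt-↭ : ∀ {a} {A : Set a} {n} (xs : Vec A n) i v → toList (insertAt xs i v) ↭ v ∷ toList xs
toList-insertAt-↭ xs       Fin.zero    v = ↭-refl
toList-insertAt-↭ (x ∷ xs) (Fin.suc i) v = ↭-trans (↭-prep x (toList-insertAt-↭ xs i v)) (↭-swap x v ↭-refl)

lookup-injective : ∀ {a} {A : Set a} {n} (v : Vec A n) → Unique (toList v) → ∀ i j → lookup v i ≡ lookup v j → i ≡ j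
lookup-injective (x ∷ v) _       Fin.zero    Fin.zero    _  = refl
lookup-injective (x ∷ v) (h ∷ _) Fin.zero    (Fin.suc j) eq = ⊥-elim (All.lookup h (∈-toList⁺ (∈-lookup j v)) eq)
lookup-injective (x ∷ v) (h ∷ _) (Fin.suc i) Fin.zero    eq = ⊥-elim (All.lookup h (∈-toList⁺ (∈-lookup i v)) (sym eq))
lookup-injective (x ∷ v) (_ ∷ u) (Fin.suc i) (Fin.suc j) eq = cong Fin.suc (lookup-injective v u i j eq)

insertMax-unique : ∀ {m l} (k : Fin (suc l)) (π : Vec (Fin m) l) → Unique (toList π) → Unique (toList (insertMax k π))
insertMax-unique {m} k π u = unique-resp-↭ (↭-sym (toList-insertAt-↭ (Vec.map inject₁ π) k (fromℕ m)))
  (subst (λ xs → Unique (fromℕ m ∷ xs)) (sym (toList-map inject₁ π))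
    (Allₚ.map⁺ (All.universal (λ _ → fromℕ≢inject₁) (toList π)) ∷ Unique.map⁺ inject₁-injective u))

insertMax-injective : ∀ {m l} {k k′ : Fin (suc l)} {π π′ : Vec (Fin m) l} →
  insertMax k π ≡ insertMax k′ π′ → k ≡ k′ × π ≡ π′
insertMax-injective {k = Fin.zero} {Fin.zero} {π} {π′} eq = refl , map-inject₁-injective π π′ (proj₂ (∷-injective eq))
  where
  map-inject₁-injective : ∀ {m l} (π π′ : Vec (Fin m) l) → Vec.map inject₁ π ≡ Vec.map inject₁ π′ → π ≡ π′
  map-inject₁-injective []      []        _  = refl
  map-inject₁-injective (x ∷ π) (x′ ∷ π′) eq =
    cong₂ _∷_ (inject₁-injective (proj₁ (∷-injective eq))) (map-inject₁-injective π π′ (proj₂ (∷-injective eq)))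
insertMax-injective {k = Fin.zero}  {Fin.suc k′} {π′ = x ∷ π′} eq = ⊥-elim (fromℕ≢inject₁ (proj₁ (∷-injective eq)))
insertMax-injective {k = Fin.suc k} {Fin.zero}   {π = x ∷ π}   eq = ⊥-elim (fromℕ≢inject₁ (sym (proj₁ (∷-injective eq))))
insertMax-injective {k = Fin.suc k} {Fin.suc k′} {x ∷ π} {x′ ∷ π′} eq with ∷-injective eq
... | x≡x′ , rest with insertMax-injective rest
... | refl , refl = refl , cong (_∷ π) (inject₁-injective x≡x′)

lower : ∀ {m l} (w : Vec (Fin (suc m)) l) → All (fromℕ m ≢_) (toList w) →
  ∃ λ (π : Vec (Fin m) l) → w ≡ Vec.map inject₁ π
lower     []      []          = [] , refl
lower {m} (y ∷ w) (y≢max ∷ w≢max) with lower w w≢max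
... | π , refl = lower₁ y m≢y ∷ π , cong (_∷ Vec.map inject₁ π) (sym (inject₁-lower₁ y m≢y))
  where
  m≢y : m ≢ toℕ y
  m≢y m≡y = y≢max (toℕ-injective (trans (toℕ-fromℕ m) m≡y))

map-inject₁-unique⁻ : ∀ {m l} (π : Vec (Fin m) l) → Unique (toList (Vec.map inject₁ π)) → Unique (toList π)
map-inject₁-unique⁻ π u = Unique.map⁻ (subst Unique (toList-map inject₁ π) u)

-- If the maximum were missing, v would inject Fin (suc m) into Fin m.
max-index : ∀ {m} (v : Vec (Fin (suc m)) (suc m)) → Unique (toList v) → ∃ λ i → lookup v i ≡ fromℕ m
max-index {m} v u with ∈Dec._∈?_ Fin._≟_ (fromℕ m) (toList v)
... | yes max∈v = index (∈-toList⁻ max∈v) , sym (lookup-index (∈-toList⁻ max∈v))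
... | no  max∉v with lower v (Allₚ.¬Any⇒All¬ (toList v) max∉v)
...   | π , refl with pigeonhole (ℕₚ.n<1+n m) (lookup π)
...     | i , j , i<j , πᵢ≡πⱼ = ⊥-elim (<⇒≢ i<j (lookup-injective π (map-inject₁-unique⁻ π u) i j πᵢ≡πⱼ))

removeMax : ∀ {m l} (v : Vec (Fin (suc m)) (suc l)) → Unique (toList v) → ∀ i → lookup v i ≡ fromℕ m →
  ∃ λ (π : Vec (Fin m) l) → Unique (toList π) × v ≡ insertMax i π
removeMax {m} v u i vᵢ≡max = π , π-unique , trans (sym v≡insertAt) (cong (λ w → insertAt w i (fromℕ m)) w≡π)
  where
  w : Vec (Fin (suc m)) _
  w = removeAt v i
  v≡insertAt : insertAt w i (fromℕ m) ≡ v
  v≡insertAt = subst (λ x → insertAt w i x ≡ v) vᵢ≡max (insertAt-removeAt v i)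
  max∷w-unique : Unique (fromℕ m ∷ toList w)
  max∷w-unique = unique-resp-↭ (toList-insertAt-↭ w i (fromℕ m)) (subst (Unique ∘ toList) (sym v≡insertAt) u)
  π = proj₁ (lower w (AllPairs.head max∷w-unique))
  w≡π = proj₂ (lower w (AllPairs.head max∷w-unique))
  π-unique : Unique (toList π)
  π-unique = map-inject₁-unique⁻ π (subst (Unique ∘ toList) w≡π (AllPairs.tail max∷w-unique))

insertions : ∀ n → List (Vec (Fin (suc n)) (suc n))
insertions n = cartesianProductWith insertMax (allFin (suc n)) (S n)

S-suc↭insertions : ∀ n → S (suc n) ↭ insertions n
S-suc↭insertions n = ∼bag⇒↭ (unique∧set⇒bag (S-unique (suc n))
    (Unique.cartesianProductWith⁺ insertMax insertMax-injective (Unique.allFin⁺ (suc n)) (S-unique n))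
    (mk⇔ to from))
  where
  to : ∀ {v} → v ∈ S (suc n) → v ∈ insertions n
  to {v} v∈S with max-index v (∈-S⁻ v∈S)
  ... | i , vᵢ≡max with removeMax v (∈-S⁻ v∈S) i vᵢ≡max
  ... | π , π-unique , refl = ∈-cartesianProductWith⁺ insertMax (∈-allFin i) (∈-S⁺ π-unique)
  from : ∀ {v} → v ∈ insertions n → v ∈ S (suc n)
  from v∈ins with ∈-cartesianProductWith⁻ insertMax (allFin (suc n)) (S n) v∈ins
  ... | k , π , _ , π∈S , refl = ∈-S⁺ (insertMax-unique k π (∈-S⁻ π∈S))

module Sequences where
  open ListSum ℕₚ.+-0-commutativeMonoid
  open import Data.Nat using (_+_)
  open ≡-Reasoning

  <ᵇ-true : ∀ {m n} → m < n → (m <ᵇ n) ≡ true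
  <ᵇ-true m<n = Equivalence.to T-≡ (ℕₚ.<⇒<ᵇ m<n)

  <ᵇ-false : ∀ {m n} → n ≤ m → (m <ᵇ n) ≡ false
  <ᵇ-false z≤n       = refl
  <ᵇ-false (s≤s n≤m) = <ᵇ-false n≤m

  [1+n]C2≡nC2+n : ∀ n → suc n C 2 ≡ n C 2 + n
  [1+n]C2≡nC2+n n = begin
    suc n C 2         ≡⟨ sym (nCk+nC[k+1]≡[n+1]C[k+1] n 1) ⟩
    n C 1 + n C 2     ≡⟨ cong (_+ n C 2) (nC1≡n n) ⟩
    n + n C 2         ≡⟨ ℕₚ.+-comm n _ ⟩
    n C 2 + n         ∎

  isNonInversion : (ℕ → ℕ) → ℕ → ℕ → Bool
  isNonInversion p a b = (a <ᵇ b) ∧ (p a <ᵇ p b)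

  -- Positions are 0-based, as in Defs.z: (a , b) straddles slot k, the gap just before position k, iff a < k ≤ b.
  crosses : ℕ → ℕ → ℕ → Bool
  crosses k a b = (a <ᵇ k) ∧ (k <ᵇ suc b)

  ninvsumSeq : ℕ → (ℕ → ℕ) → ℕ
  ninvsumSeq l p = sumUpTo l λ a → sumUpTo l λ b → if isNonInversion p a b then b ∸ a else 0

  zSeq : ℕ → ℕ → (ℕ → ℕ) → ℕ
  zSeq l k p = sumUpTo l λ a → sumUpTo l λ b → if isNonInversion p a b then (if crosses k a b then 1 else 0) else 0

  firstRowNinvsum : ℕ → (ℕ → ℕ) → ℕ
  firstRowNinvsum l p = sumUpTo l λ b → if p 0 <ᵇ p (suc b) then suc b else 0

  firstRowZ : ℕ → ℕ → (ℕ → ℕ) → ℕ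
  firstRowZ l k p = sumUpTo l λ b → if p 0 <ᵇ p (suc b) then (if k <ᵇ suc b then 1 else 0) else 0

  -- Definitional: a pair (suc a , suc b) of p is the pair (a , b) of p ∘ suc, and no pair (a , 0) counts.
  ninvsumSeq-suc : ∀ l p → ninvsumSeq (suc l) p ≡ firstRowNinvsum l p + ninvsumSeq l (p ∘ suc)
  ninvsumSeq-suc l p = refl

  zSeq-suc : ∀ l k p → zSeq (suc l) (suc k) p ≡ firstRowZ l k p + zSeq l k (p ∘ suc)
  zSeq-suc l k p = refl

  ninvsumSeq-cong : ∀ l {p p′ : ℕ → ℕ} → (∀ i → p i ≡ p′ i) → ninvsumSeq l p ≡ ninvsumSeq l p′
  ninvsumSeq-cong l p≡p′ = sumUpTo-cong l λ a _ → sumUpTo-cong l λ b _ →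
    cong₂ (λ x y → if (a <ᵇ b) ∧ (x <ᵇ y) then b ∸ a else 0) (p≡p′ a) (p≡p′ b)

  zSeq-zero : ∀ l p → zSeq l 0 p ≡ 0
  zSeq-zero l p = sumUpTo-ε l λ a _ → sumUpTo-ε l λ b _ → if-eta (isNonInversion p a b)

  zSeq-length : ∀ l p → zSeq l l p ≡ 0
  zSeq-length l p = sumUpTo-ε l λ a _ → sumUpTo-ε l λ b b<l →
    trans (cong (λ c → if isNonInversion p a b then (if (a <ᵇ l) ∧ c then 1 else 0) else 0) (<ᵇ-false b<l))
          (trans (cong (λ c → if isNonInversion p a b then (if c then 1 else 0) else 0) (∧-zeroʳ (a <ᵇ l)))
                 (if-eta (isNonInversion p a b)))

  insertSeq : ℕ → ℕ → (ℕ → ℕ) → ℕ → ℕ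
  insertSeq v zero    p zero    = v
  insertSeq v zero    p (suc i) = p i
  insertSeq v (suc k) p zero    = p 0
  insertSeq v (suc k) p (suc i) = insertSeq v k (p ∘ suc) i

  -- Once v > x is inserted at slot k, the old entry at b sits at b + 1 exactly when k ≤ b, and v contributes w k.
  sumUpTo-insertSeq : ∀ k l x v (r w : ℕ → ℕ) → k ≤ l → x < v →
    sumUpTo (suc l) (λ b → if x <ᵇ insertSeq v k r b then w b else 0)
      ≡ sumUpTo l (λ b → if x <ᵇ r b then (if k <ᵇ suc b then w (suc b) else w b) else 0) + w k
  sumUpTo-insertSeq zero    l       x v r w _         x<v rewrite <ᵇ-true x<v = ℕₚ.+-comm (w 0) _
  sumUpTo-insertSeq (suc k) (suc l) x v r w (s≤s k≤l) x<v =
    trans (cong (row₀ +_) (sumUpTo-insertSeq k l x v (r ∘ suc) (w ∘ suc) k≤l x<v)) (sym (ℕₚ.+-assoc row₀ _ _))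
    where
    row₀ : ℕ
    row₀ = if x <ᵇ r 0 then w 0 else 0

  shifted-distance-split : ∀ c d b → (if c then (if d then suc (suc b) else suc b) else 0)
                                  ≡ (if c then suc b else 0) + (if c then (if d then 1 else 0) else 0)
  shifted-distance-split true  true  b = cong suc (ℕₚ.+-comm 1 b)
  shifted-distance-split true  false b = sym (ℕₚ.+-identityʳ (suc b))
  shifted-distance-split false d     b = refl

  firstRowNinvsum-insertSeq-suc : ∀ k l v p → k ≤ l → p 0 < v →
    firstRowNinvsum (suc l) (insertSeq v (suc k) p) ≡ firstRowNinvsum l p + firstRowZ l k p + suc k
  firstRowNinvsum-insertSeq-suc k l v p k≤l p₀<v = begin
    sumUpTo (suc l) (λ b → if p 0 <ᵇ insertSeq v k (p ∘ suc) b then suc b else 0)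
      ≡⟨ sumUpTo-insertSeq k l (p 0) v (p ∘ suc) suc k≤l p₀<v ⟩
    sumUpTo l (λ b → if p 0 <ᵇ p (suc b) then (if k <ᵇ suc b then suc (suc b) else suc b) else 0) + suc k
      ≡⟨ cong (_+ suc k) (sumUpTo-cong l (λ b _ → shifted-distance-split (p 0 <ᵇ p (suc b)) (k <ᵇ suc b) b)) ⟩
    sumUpTo l (λ b → (if p 0 <ᵇ p (suc b) then suc b else 0)
                     + (if p 0 <ᵇ p (suc b) then (if k <ᵇ suc b then 1 else 0) else 0)) + suc k
      ≡⟨ cong (_+ suc k) (sumUpTo-distrib l _ _) ⟩
    firstRowNinvsum l p + firstRowZ l k p + suc k ∎

  firstRowNinvsum-insertSeq-zero : ∀ l v p → (∀ i → i < l → p i < v) → firstRowNinvsum l (insertSeq v 0 p) ≡ 0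
  firstRowNinvsum-insertSeq-zero l v p p<v =
    sumUpTo-ε l λ b b<l → cong (λ c → if c then suc b else 0) (<ᵇ-false (ℕₚ.<⇒≤ (p<v b b<l)))

  ninvsumSeq-insertSeq : ∀ k l v p → k ≤ l → (∀ i → i < l → p i < v) →
    ninvsumSeq (suc l) (insertSeq v k p) ≡ suc k C 2 + zSeq l k p + ninvsumSeq l p
  ninvsumSeq-insertSeq zero l v p _ p<v = begin
    ninvsumSeq (suc l) (insertSeq v 0 p)
      ≡⟨ ninvsumSeq-suc l (insertSeq v 0 p) ⟩
    firstRowNinvsum l (insertSeq v 0 p) + ninvsumSeq l p
      ≡⟨ cong (_+ ninvsumSeq l p) (firstRowNinvsum-insertSeq-zero l v p p<v) ⟩
    ninvsumSeq l p
      ≡⟨ cong (_+ ninvsumSeq l p) (sym (zSeq-zero l p)) ⟩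
    1 C 2 + zSeq l 0 p + ninvsumSeq l p ∎
  ninvsumSeq-insertSeq (suc k) zero    v p () p<v
  ninvsumSeq-insertSeq (suc k) (suc l) v p (s≤s k≤l) p<v = begin
    ninvsumSeq (suc (suc l)) (insertSeq v (suc k) p)
      ≡⟨ ninvsumSeq-suc (suc l) (insertSeq v (suc k) p) ⟩
    firstRowNinvsum (suc l) (insertSeq v (suc k) p) + ninvsumSeq (suc l) (insertSeq v k p′)
      ≡⟨ cong₂ _+_ (firstRowNinvsum-insertSeq-suc k l v p k≤l (p<v 0 z<s))
                   (ninvsumSeq-insertSeq k l v p′ k≤l (λ i i<l → p<v (suc i) (s<s i<l))) ⟩
    (firstRowNinvsum l p + firstRowZ l k p + suc k) + (suc k C 2 + zSeq l k p′ + ninvsumSeq l p′)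
      ≡⟨ rearrange (firstRowNinvsum l p) (firstRowZ l k p) (suc k) (suc k C 2) (zSeq l k p′) (ninvsumSeq l p′) ⟩
    (suc k C 2 + suc k) + (firstRowZ l k p + zSeq l k p′) + (firstRowNinvsum l p + ninvsumSeq l p′)
      ≡⟨ cong (λ t → t + (firstRowZ l k p + zSeq l k p′) + (firstRowNinvsum l p + ninvsumSeq l p′))
              (sym ([1+n]C2≡nC2+n (suc k))) ⟩
    suc (suc k) C 2 + (firstRowZ l k p + zSeq l k p′) + (firstRowNinvsum l p + ninvsumSeq l p′)
      ≡⟨ cong₂ (λ s t → suc (suc k) C 2 + s + t) (sym (zSeq-suc l k p)) (sym (ninvsumSeq-suc l p)) ⟩
    suc (suc k) C 2 + zSeq (suc l) (suc k) p + ninvsumSeq (suc l) p ∎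
    where
    p′ : ℕ → ℕ
    p′ = p ∘ suc
    open import Data.Nat.Tactic.RingSolver using (solve-∀)
    rearrange : ∀ a b c d e f → (a + b + c) + (d + e + f) ≡ (d + c) + (b + e) + (a + f)
    rearrange = solve-∀

  -- Junk value 0 past the end; only positions below the length are ever read.
  entry : ∀ {m l} → Vec (Fin m) l → ℕ → ℕ
  entry []      i       = 0
  entry (x ∷ π) zero    = toℕ x
  entry (x ∷ π) (suc i) = entry π i

  lookup-entry : ∀ {m l} (π : Vec (Fin m) l) a → toℕ (lookup π a) ≡ entry π (toℕ a)
  lookup-entry (x ∷ π) Fin.zero    = refl
  lookup-entry (x ∷ π) (Fin.suc a) = lookup-entry π a

  entry< : ∀ {m l} (π : Vec (Fin m) l) i → i < l → entry π i < m
  entry< (x ∷ π) zero    _         = toℕ<n x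
  entry< (x ∷ π) (suc i) (s<s i<l) = entry< π i i<l

  sum-map-nonInversions : ∀ {n} (π : Vec (Fin n) n) (w : Fin n × Fin n → ℕ) (h : ℕ → ℕ → ℕ) →
    (∀ a b → w (a , b) ≡ h (toℕ a) (toℕ b)) →
    sum (map w (nonInversions π)) ≡ sumUpTo n λ a → sumUpTo n λ b → if isNonInversion (entry π) a b then h a b else 0
  sum-map-nonInversions {n} π w h w≡h = begin
    sum (map w (nonInversions π))
      ≡⟨ sum-filter _ w (pairs n) ⟩
    sum (map g (pairs n))
      ≡⟨ sum-concatMap g (λ a → map (a ,_) (allFin n)) (allFin n) ⟩
    sum (map (λ a → sum (map g (map (a ,_) (allFin n)))) (allFin n))
      ≡⟨ sum-map-allFin n _ _ (λ a → trans (cong sum (sym (map-∘ (allFin n)))) (sum-map-allFin n _ _ (g≡ a))) ⟩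
    (sumUpTo n λ a → sumUpTo n λ b → if isNonInversion (entry π) a b then h a b else 0) ∎
    where
    g : Fin n × Fin n → ℕ
    g (a , b) = if (toℕ a <ᵇ toℕ b) ∧ (toℕ (lookup π a) <ᵇ toℕ (lookup π b)) then w (a , b) else 0
    g≡ : ∀ a b → g (a , b) ≡ (if isNonInversion (entry π) (toℕ a) (toℕ b) then h (toℕ a) (toℕ b) else 0)
    g≡ a b rewrite lookup-entry π a | lookup-entry π b | w≡h a b = refl

  ninvsum≡ninvsumSeq : ∀ {n} (π : Vec (Fin n) n) → ninvsum π ≡ ninvsumSeq n (entry π)
  ninvsum≡ninvsumSeq π = sum-map-nonInversions π _ (λ a b → b ∸ a) (λ _ _ → refl)

  length≡sum-map-1 : ∀ {a} {A : Set a} (xs : List A) → List.length xs ≡ sum (map (λ _ → 1) xs)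
  length≡sum-map-1 []       = refl
  length≡sum-map-1 (x ∷ xs) = cong suc (length≡sum-map-1 xs)

  ≤ᵇ≡<ᵇsuc : ∀ k b → (k ≤ᵇ b) ≡ (k <ᵇ suc b)
  ≤ᵇ≡<ᵇsuc zero    b = refl
  ≤ᵇ≡<ᵇsuc (suc k) b = refl

  z≡zSeq : ∀ {n} k (π : Vec (Fin n) n) → z k π ≡ zSeq n k (entry π)
  z≡zSeq {n} k π = begin
    List.length (filter _ (nonInversions π))
      ≡⟨ length≡sum-map-1 (filter _ (nonInversions π)) ⟩
    sum (map (λ _ → 1) (filter _ (nonInversions π)))
      ≡⟨ sum-filter _ _ (nonInversions π) ⟩
    sum (map _ (nonInversions π))
      ≡⟨ sum-map-nonInversions π _ (λ a b → if crosses k a b then 1 else 0)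
           (λ a b → cong (λ c → if (toℕ a <ᵇ k) ∧ c then 1 else 0) (≤ᵇ≡<ᵇsuc k (toℕ b))) ⟩
    zSeq n k (entry π) ∎

  entry-map-inject₁ : ∀ {m l} (π : Vec (Fin m) l) i → entry (Vec.map inject₁ π) i ≡ entry π i
  entry-map-inject₁ []      i       = refl
  entry-map-inject₁ (x ∷ π) zero    = toℕ-inject₁ x
  entry-map-inject₁ (x ∷ π) (suc i) = entry-map-inject₁ π i

  entry-insertMax : ∀ {m l} (k : Fin (suc l)) (π : Vec (Fin m) l) i → entry (insertMax k π) i ≡ insertSeq m (toℕ k) (entry π) i
  entry-insertMax {m} Fin.zero    π       zero    = toℕ-fromℕ m
  entry-insertMax     Fin.zero    π       (suc i) = entry-map-inject₁ π i
  entry-insertMax     (Fin.suc k) (x ∷ π) zero    = toℕ-inject₁ x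
  entry-insertMax     (Fin.suc k) (x ∷ π) (suc i) = entry-insertMax k π i

  ninvsum-insertMax : ∀ {n} (k : Fin (suc n)) (π : Vec (Fin n) n) →
    ninvsum (insertMax k π) ≡ suc (toℕ k) C 2 + z (toℕ k) π + ninvsum π
  ninvsum-insertMax {n} k π = begin
    ninvsum (insertMax k π)
      ≡⟨ ninvsum≡ninvsumSeq (insertMax k π) ⟩
    ninvsumSeq (suc n) (entry (insertMax k π))
      ≡⟨ ninvsumSeq-cong (suc n) (entry-insertMax k π) ⟩
    ninvsumSeq (suc n) (insertSeq n (toℕ k) (entry π))
      ≡⟨ ninvsumSeq-insertSeq (toℕ k) n n (entry π) (toℕ≤pred[n] k) (entry< π) ⟩
    suc (toℕ k) C 2 + zSeq n (toℕ k) (entry π) + ninvsumSeq n (entry π)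
      ≡⟨ cong₂ (λ s t → suc (toℕ k) C 2 + s + t) (sym (z≡zSeq (toℕ k) π)) (sym (ninvsum≡ninvsumSeq π)) ⟩
    suc (toℕ k) C 2 + z (toℕ k) π + ninvsum π ∎

  z-zero : ∀ {n} (π : Vec (Fin n) n) → z 0 π ≡ 0
  z-zero {n} π = trans (z≡zSeq 0 π) (zSeq-zero n (entry π))

  z-length : ∀ {n} (π : Vec (Fin n) n) → z n π ≡ 0
  z-length {n} π = trans (z≡zSeq n π) (zSeq-length n (entry π))

  aug≡z : ∀ {n} k (π : Vec (Fin n) n) → k ≤ n → aug k π ≡ z k π
  aug≡z zero π _ = sym (z-zero π)
  aug≡z {n} (suc k) π _ with suc k ≟ n
  ... | yes refl = sym (z-length π)
  ... | no _     = refl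

open Sequences using (ninvsum-insertMax; z-zero; z-length; aug≡z)

module Expansion {c ℓ} (R : CommutativeSemiring c ℓ) (q : CommutativeSemiring.Carrier R) where
  open CommutativeSemiring R renaming (refl to ≈-refl; sym to ≈-sym; trans to ≈-trans)
  open Poly R
  open ListSum +-commutativeMonoid
  open import Algebra.Properties.Semiring.Exp semiring using (_^_; ^-homo-*)
  open import Relation.Binary.Reasoning.Setoid setoid

  sum-map-*ˡ : ∀ {a} {A : Set a} (x : Carrier) (f : A → Carrier) xs → sum (map (λ y → x * f y) xs) ≈ x * sum (map f xs)
  sum-map-*ˡ x f []       = ≈-sym (zeroʳ x)
  sum-map-*ˡ x f (y ∷ ys) = ≈-trans (+-congˡ (sum-map-*ˡ x f ys)) (≈-sym (distribˡ x _ _))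

  q^ninvsum-insertMax : ∀ {n} (k : Fin (suc n)) (π : Vec (Fin n) n) →
    q ^ ninvsum (insertMax k π) ≈ q ^ (suc (toℕ k) C 2) * (q ^ aug (toℕ k) π * q ^ ninvsum π)
  q^ninvsum-insertMax k π = begin
    q ^ ninvsum (insertMax k π)
      ≡⟨ cong (q ^_) (ninvsum-insertMax k π) ⟩
    q ^ (t ℕ.+ z i π ℕ.+ ninvsum π)
      ≈⟨ ^-homo-* q (t ℕ.+ z i π) (ninvsum π) ⟩
    q ^ (t ℕ.+ z i π) * q ^ ninvsum π
      ≈⟨ *-congʳ (^-homo-* q t (z i π)) ⟩
    q ^ t * q ^ z i π * q ^ ninvsum π
      ≈⟨ *-assoc _ _ _ ⟩
    q ^ t * (q ^ z i π * q ^ ninvsum π)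
      ≡⟨ cong (λ e → q ^ t * (q ^ e * q ^ ninvsum π)) (sym (aug≡z i π (toℕ≤pred[n] k))) ⟩
    q ^ t * (q ^ aug i π * q ^ ninvsum π) ∎
    where
    i t : ℕ
    i = toℕ k
    t = suc i C 2

  N-suc≈middle : ∀ n → N (suc n) q ≈ middle n q
  N-suc≈middle n = begin
    N (suc n) q
      ≈⟨ sum-map-↭ (λ π → q ^ ninvsum π) (S-suc↭insertions n) ⟩
    sum (map (λ π → q ^ ninvsum π) (insertions n))
      ≈⟨ sum-cartesianProductWith (λ π → q ^ ninvsum π) insertMax (allFin (suc n)) (S n) ⟩
    sum (map (λ k → sum (map (λ π → q ^ ninvsum (insertMax k π)) (S n))) (allFin (suc n)))
      ≈⟨ sum-map-allFin (suc n) _ T insertionsAt≈T ⟩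
    sumUpTo (suc n) T
      ≡⟨ sym (sum-map-upTo (suc n) T) ⟩
    middle n q ∎
    where
    T : ℕ → Carrier
    T k = q ^ (suc k C 2) * Aterm n k q
    insertionsAt≈T : ∀ k → sum (map (λ π → q ^ ninvsum (insertMax k π)) (S n)) ≈ T (toℕ k)
    insertionsAt≈T k = ≈-trans (sum-map-cong (S n) (q^ninvsum-insertMax k)) (sum-map-*ˡ _ _ (S n))

  Aterm≈Zterm : ∀ n k → k ≤ n → Aterm n k q ≈ Zterm n k q
  Aterm≈Zterm n k k≤n = sum-map-cong (S n) λ π → reflexive (cong (λ e → q ^ e * q ^ ninvsum π) (aug≡z k π k≤n))

  Zterm≈N : ∀ n k → (∀ (π : Vec (Fin n) n) → z k π ≡ 0) → Zterm n k q ≈ N n q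
  Zterm≈N n k z≡0 = sum-map-cong (S n) λ π →
    ≈-trans (reflexive (cong (λ e → q ^ e * q ^ ninvsum π) (z≡0 π))) (*-identityˡ _)

  middle≈right : ∀ n → n ≥ 1 → middle n q ≈ right n q
  middle≈right n@(suc m) _ = begin
    middle n q
      ≡⟨ sum-map-upTo (suc n) T ⟩
    T 0 + sumUpTo n (T ∘ suc)
      ≈⟨ +-congˡ (sumUpTo-suc m (T ∘ suc)) ⟩
    T 0 + (sumUpTo m (T ∘ suc) + T n)
      ≈⟨ +-cong T₀≈N (+-cong (sumUpTo-cong m Tₖ≈Zₖ) Tₙ≈q^N) ⟩
    N n q + (sumUpTo m Z + q ^ (suc n C 2) * N n q)
      ≈⟨ ≈-sym (+-assoc _ _ _) ⟩
    N n q + sumUpTo m Z + q ^ (suc n C 2) * N n q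
      ≡⟨ cong (λ s → N n q + s + q ^ (suc n C 2) * N n q) (sym (sum-map-upTo m Z)) ⟩
    right n q ∎
    where
    T Z : ℕ → Carrier
    T k = q ^ (suc k C 2) * Aterm n k q
    Z k = q ^ (suc (suc k) C 2) * Zterm n (suc k) q
    T₀≈N : T 0 ≈ N n q
    T₀≈N = ≈-trans (*-identityˡ _) (≈-trans (Aterm≈Zterm n 0 z≤n) (Zterm≈N n 0 z-zero))
    Tₖ≈Zₖ : ∀ k → k < m → T (suc k) ≈ Z k
    Tₖ≈Zₖ k k<m = *-congˡ (Aterm≈Zterm n (suc k) (s≤s (ℕₚ.<⇒≤ k<m)))
    Tₙ≈q^N : T n ≈ q ^ (suc n C 2) * N n q
    Tₙ≈q^N = *-congˡ (≈-trans (Aterm≈Zterm n n ℕₚ.≤-refl) (Zterm≈N n n z-length))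

theorem3p8 : {c ℓ : Level} (R : CommutativeSemiring c ℓ) (q : CommutativeSemiring.Carrier R) (n : ℕ) → n ≥ 1 →
    let open CommutativeSemiring R in
    let open Poly R in
    (N (suc n) q ≈ middle n q) × (middle n q ≈ right n q)
theorem3p8 R q n n≥1 = N-suc≈middle n , middle≈right n n≥1
  where open Expansion R q
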